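{- Let $X=[n]$, let $\mathcal{A},\mathcal{B}\subset\mathcal{P}(X)$ be left-compressed families, and let $\mathcal{C}$ be a maximal chain in $\mathcal{P}(X)$ chosen uniformly at random. Then for any $k,l$, \[ \mathbb{P}\big(N_{\mathcal{A}}(\mathcal{C})\ge k,\ N_{\mathcal{B}}(\mathcal{C})\ge l\big)\ge\mathbb{P}\big(N_{\mathcal{A}}(\mathcal{C})\ge k\big)\cdot\mathbb{P}\big(N_{\mathcal{B}}(\mathcal{C})\ge l\big). \]
   Context: A family $\mathcal{A}\subset\mathcal{P}([n])$ is left-compressed if for any $1\le i<j\le n$, whenever $A\in\mathcal{A}$ with $i\notin A$, $j\in A$, also $(A\setminus\{j\})\cup\{i\}\in\mathcal{A}$. A maximal chain in $\mathcal{P}(X)$ is a sequence $C_0\subset C_1\subset\cdots\subset C_n$ of subsets of $X$ with $|C_i|=i$. For a family $\mathcal{F}\subset\mathcal{P}(X)$ and a maximal chain $\mathcal{C}$, $N_{\mathcal{F}}(\mathcal{C}):=|\mathcal{C}\cap\mathcal{F}|$ is the number of sets of the chain that lie in $\mathcal{F}$. -}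

module Defs where

open import Data.Nat using (ℕ; zero; suc; _≤_; _≤?_)
open import Data.Nat.Properties using (_≟_)
open import Data.Bool using (Bool; true; false; T; T?)
open import Data.Fin using (Fin; toℕ; inject₁) renaming (_<_ to _<ᶠ_; suc to fsuc)
open import Data.Fin.Properties using (all?)
open import Data.Fin.Subset using (Subset; inside; outside; _∈_; _∉_; _⊆_; ∣_∣)
open import Data.Fin.Subset.Properties using (_⊆?_)
open import Data.Vec using (Vec; []; _∷_; lookup; toList; _[_]≔_)
open import Data.List using (List; []; _∷_; map; _++_; concatMap; filter; length)
open import Data.Product using (_×_)
open import Relation.Binary.PropositionalEquality using (_≡_)
open import Relation.Nullary.Decidable using (Dec; _×-dec_)

Family : ℕ → Set
Family n = Subset n → Bool

LeftCompressed : ∀ {n} → Family n → Set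
LeftCompressed {n} F =
  ∀ (i j : Fin n) → i <ᶠ j → ∀ (A : Subset n) → i ∉ A → j ∈ A →
  F A ≡ true → F ((A [ j ]≔ outside) [ i ]≔ inside) ≡ true

allSubsets : ∀ n → List (Subset n)
allSubsets zero = [] ∷ []
allSubsets (suc n) = map (outside ∷_) (allSubsets n) ++ map (inside ∷_) (allSubsets n)

allSeqs : ∀ {n} m → List (Vec (Subset n) m)
allSeqs zero = [] ∷ []
allSeqs {n} (suc m) = concatMap (λ S → map (S ∷_) (allSeqs m)) (allSubsets n)

IsMaxChain : ∀ {n} → Vec (Subset n) (suc n) → Set
IsMaxChain {n} c =
  (∀ (i : Fin (suc n)) → ∣ lookup c i ∣ ≡ toℕ i) ×
  (∀ (i : Fin n) → lookup c (inject₁ i) ⊆ lookup c (fsuc i))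

isMaxChain? : ∀ {n} (c : Vec (Subset n) (suc n)) → Dec (IsMaxChain c)
isMaxChain? {n} c =
  all? (λ i → ∣ lookup c i ∣ ≟ toℕ i) ×-dec all? (λ i → lookup c (inject₁ i) ⊆? lookup c (fsuc i))

maxChains : ∀ n → List (Vec (Subset n) (suc n))
maxChains n = filter isMaxChain? (allSeqs (suc n))

N : ∀ {n} {m} → Family n → Vec (Subset n) m → ℕ
N F c = length (filter (λ S → T? (F S)) (toList c))

countAB : ∀ {n} → Family n → ℕ → Family n → ℕ → ℕ
countAB {n} A k B l = length (filter (λ c → k ≤? N A c ×-dec l ≤? N B c) (maxChains n))

countA : ∀ {n} → Family n → ℕ → ℕ
countA {n} F k = length (filter (λ c → k ≤? N F c) (maxChains n))

module Submission where

-- A maximal chain of [n] adds one element at a time. Recording the element added first,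
-- as c ∈ Fin (n + 1), and then recursively the chain it induces on the remaining n
-- elements identifies maximal chains with Lehmer codes Fin (n + 1) × Fin n × ⋯ × Fin 1,
-- a product of finite chains. For a left-compressed family F, lowering the first added
-- element from c + 1 to c replaces every set of the chain by a left shift of itself, so
-- N_F can only grow: N_F is decreasing in each coordinate of the code, and so are the
-- indicators of N_A ≥ k and N_B ≥ l. The Harris inequality on a product of chains,
-- proved coordinate by coordinate from Chebyshev's sum inequality, gives the claim.

open import Defs
open import Data.Bool as Bool using (true; false; if_then_else_; T?)
open import Data.Fin as Fin using (Fin; zero; suc; inject₁; toℕ; punchIn) renaming (_<_ to _<ᶠ_)
import Data.Fin.Properties as Finₚ
open import Data.Fin.Subset using (Subset; inside; outside; ⊥; _∈_; _∉_; _⊆_; ∣_∣; _-_; Nonempty)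
open import Data.Fin.Subset.Properties
  using (⊆-min; drop-∷-⊆; out⊆; in⊆in; s⊆s; Empty-unique; nonempty?; ∣⊥∣≡0; x∈p⇒∣p-x∣<∣p∣)
open import Data.List using (List; []; _∷_; map; _++_; concatMap; filter; length)
open import Data.List.Properties using (++-identityʳ)
open import Data.Nat using (ℕ; zero; suc; _+_; _*_; _≤_; _<_; _≥_; _≤?_; z≤n)
open import Data.Nat.Properties
open import Algebra.Properties.Semiring.Sum +-*-semiring
  using (sum; sum-syntax; sum-cong-≗; ∑-distrib-+; *-distribˡ-sum)
open import Data.Nat.Tactic.RingSolver using (solve-∀)
open import Data.Product using (_×_; _,_; ∃; proj₁; proj₂; <_,_>; uncurry)
open import Data.Product.Properties using (,-injectiveˡ; ,-injectiveʳ)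
open import Data.Unit as Unit using (⊤; tt)
open import Data.Vec as Vec using (Vec; []; _∷_; lookup; insertAt; removeAt; _[_]≔_; here)
import Data.Vec.Properties as Vecₚ
open Vecₚ using ([]=⇒lookup; lookup⇒[]=; insertAt-removeAt; lookup-map)
open import Function using (_∘_)
open import Relation.Binary.Definitions using (DecidableEquality)
open import Relation.Binary.PropositionalEquality
open import Relation.Nullary using (Dec; does; yes; no; _because_; ¬_; contradiction)
open import Relation.Nullary.Decidable using (_×-dec_; map′)

𝟙 : ∀ {P : Set} → Dec P → ℕ
𝟙 d = if does d then 1 else 0

𝟙-cong : ∀ {P Q : Set} (d : Dec P) (e : Dec Q) → (P → Q) → (Q → P) → 𝟙 d ≡ 𝟙 e
𝟙-cong (yes _) (yes _) _ _ = refl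
𝟙-cong (yes p) (no ¬q) f _ = contradiction (f p) ¬q
𝟙-cong (no ¬p) (yes q) _ g = contradiction (g q) ¬p
𝟙-cong (no _)  (no _)  _ _ = refl

𝟙-× : ∀ {P Q : Set} (d : Dec P) (e : Dec Q) → 𝟙 (d ×-dec e) ≡ 𝟙 d * 𝟙 e
𝟙-× (true because _)  (true because _)  = refl
𝟙-× (true because _)  (false because _) = refl
𝟙-× (false because _) _                 = refl

𝟙-mono : ∀ {P Q : Set} (d : Dec P) (e : Dec Q) → (P → Q) → 𝟙 d ≤ 𝟙 e
𝟙-mono (no _)  _      _ = z≤n
𝟙-mono (yes _) (yes _) _ = ≤-refl
𝟙-mono (yes p) (no ¬q) f = contradiction (f p) ¬q

𝟙-no : ∀ {P : Set} (d : Dec P) → ¬ P → 𝟙 d ≡ 0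
𝟙-no (yes p) ¬p = contradiction p ¬p
𝟙-no (no _)  _  = refl

𝟙-≤?-mono : ∀ k {x y} → x ≤ y → 𝟙 (k ≤? x) ≤ 𝟙 (k ≤? y)
𝟙-≤?-mono k {x} {y} x≤y = 𝟙-mono (k ≤? x) (k ≤? y) (λ k≤x → ≤-trans k≤x x≤y)

𝟙≟-*-subst : ∀ {X : Set} (_≟_ : DecidableEquality X) (P : X → ℕ) x y → 𝟙 (x ≟ y) * P x ≡ 𝟙 (x ≟ y) * P y
𝟙≟-*-subst _≟_ P x y with x ≟ y
... | yes refl = refl
... | no _     = refl

∑ₗ : ∀ {A : Set} → List A → (A → ℕ) → ℕ
∑ₗ []       f = 0
∑ₗ (x ∷ xs) f = f x + ∑ₗ xs f

∑ₗ-cong : ∀ {A : Set} (xs : List A) {f g : A → ℕ} → (∀ x → f x ≡ g x) → ∑ₗ xs f ≡ ∑ₗ xs g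
∑ₗ-cong []       f≗g = refl
∑ₗ-cong (x ∷ xs) f≗g = cong₂ _+_ (f≗g x) (∑ₗ-cong xs f≗g)

∑ₗ-mono-≤ : ∀ {A : Set} (xs : List A) {f g : A → ℕ} → (∀ x → f x ≤ g x) → ∑ₗ xs f ≤ ∑ₗ xs g
∑ₗ-mono-≤ []       f≤g = z≤n
∑ₗ-mono-≤ (x ∷ xs) f≤g = +-mono-≤ (f≤g x) (∑ₗ-mono-≤ xs f≤g)

∑ₗ-++ : ∀ {A : Set} (xs ys : List A) (f : A → ℕ) → ∑ₗ (xs ++ ys) f ≡ ∑ₗ xs f + ∑ₗ ys f
∑ₗ-++ []       ys f = refl
∑ₗ-++ (x ∷ xs) ys f = trans (cong (f x +_) (∑ₗ-++ xs ys f)) (sym (+-assoc (f x) _ _))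

∑ₗ-map : ∀ {A B : Set} (g : A → B) (xs : List A) (f : B → ℕ) → ∑ₗ (map g xs) f ≡ ∑ₗ xs (f ∘ g)
∑ₗ-map g []       f = refl
∑ₗ-map g (x ∷ xs) f = cong (f (g x) +_) (∑ₗ-map g xs f)

∑ₗ-concatMap : ∀ {A B : Set} (g : A → List B) (xs : List A) (f : B → ℕ) →
  ∑ₗ (concatMap g xs) f ≡ ∑ₗ xs (λ x → ∑ₗ (g x) f)
∑ₗ-concatMap g []       f = refl
∑ₗ-concatMap g (x ∷ xs) f =
  trans (∑ₗ-++ (g x) (concatMap g xs) f) (cong (∑ₗ (g x) f +_) (∑ₗ-concatMap g xs f))

∑ₗ-*ʳ : ∀ {A : Set} (xs : List A) (f : A → ℕ) (c : ℕ) → ∑ₗ xs (λ x → f x * c) ≡ ∑ₗ xs f * c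
∑ₗ-*ʳ []       f c = refl
∑ₗ-*ʳ (x ∷ xs) f c = trans (cong (f x * c +_) (∑ₗ-*ʳ xs f c)) (sym (*-distribʳ-+ c (f x) _))

∑ₗ-*ˡ : ∀ {A : Set} (xs : List A) c (f : A → ℕ) → ∑ₗ xs (λ x → c * f x) ≡ c * ∑ₗ xs f
∑ₗ-*ˡ xs c f = trans (∑ₗ-cong xs (λ x → *-comm c (f x))) (trans (∑ₗ-*ʳ xs f c) (*-comm (∑ₗ xs f) c))

∑ₗ-filter : ∀ {A : Set} {P : A → Set} (P? : ∀ x → Dec (P x)) (xs : List A) (f : A → ℕ) →
  ∑ₗ (filter P? xs) f ≡ ∑ₗ xs (λ x → 𝟙 (P? x) * f x)
∑ₗ-filter P? []       f = refl
∑ₗ-filter P? (x ∷ xs) f with P? x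
... | yes _ = cong₂ _+_ (sym (+-identityʳ (f x))) (∑ₗ-filter P? xs f)
... | no _  = ∑ₗ-filter P? xs f

length-filter : ∀ {A : Set} {P : A → Set} (P? : ∀ x → Dec (P x)) (xs : List A) →
  length (filter P? xs) ≡ ∑ₗ xs (𝟙 ∘ P?)
length-filter P? []       = refl
length-filter P? (x ∷ xs) with P? x
... | yes _ = cong suc (length-filter P? xs)
... | no _  = length-filter P? xs

length≡∑ₗ1 : ∀ {A : Set} (xs : List A) → length xs ≡ ∑ₗ xs (λ _ → 1)
length≡∑ₗ1 []       = refl
length≡∑ₗ1 (x ∷ xs) = cong suc (length≡∑ₗ1 xs)

∑-mono-≤ : ∀ {n} {f g : Fin n → ℕ} → (∀ i → f i ≤ g i) → sum f ≤ sum g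
∑-mono-≤ {zero}  f≤g = z≤n
∑-mono-≤ {suc n} f≤g = +-mono-≤ (f≤g zero) (∑-mono-≤ (f≤g ∘ suc))

∑-const : ∀ n c → ∑[ i < n ] c ≡ n * c
∑-const zero    c = refl
∑-const (suc n) c = cong (c +_) (∑-const n c)

∑-𝟙≟ : ∀ {n} (j : Fin n) → ∑[ i < n ] 𝟙 (j Fin.≟ i) ≡ 1
∑-𝟙≟ {suc n} zero    = cong suc (begin
  ∑[ i < n ] 𝟙 (zero Fin.≟ suc i) ≡⟨ sum-cong-≗ {n} (λ i → 𝟙-no (zero Fin.≟ suc i) λ ()) ⟩
  ∑[ i < n ] 0                     ≡⟨ ∑-const n 0 ⟩
  n * 0                            ≡⟨ *-zeroʳ n ⟩
  0                                ∎)
  where open ≡-Reasoning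
∑-𝟙≟ {suc n} (suc j) = begin
  ∑[ i < n ] 𝟙 (suc j Fin.≟ suc i) ≡⟨ sum-cong-≗ {n} (λ i → 𝟙-cong (suc j Fin.≟ suc i) (j Fin.≟ i) Finₚ.suc-injective (cong suc)) ⟩
  ∑[ i < n ] 𝟙 (j Fin.≟ i)         ≡⟨ ∑-𝟙≟ j ⟩
  1                                ∎
  where open ≡-Reasoning

Decreasing : ∀ {m} → (Fin (suc m) → ℕ) → Set
Decreasing {m} F = ∀ (i : Fin m) → F (suc i) ≤ F (inject₁ i)

Decreasing⇒≤head : ∀ {m} {F : Fin (suc m) → ℕ} → Decreasing F → ∀ i → F i ≤ F zero
Decreasing⇒≤head         F↓ zero    = ≤-refl
Decreasing⇒≤head {suc m} {F} F↓ (suc i) = ≤-trans (Decreasing⇒≤head {F = F ∘ suc} (F↓ ∘ suc) i) (F↓ zero)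

-- (a − x) (b − y) ≥ 0 with the subtractions cleared.
a*y+b*x≤a*b+x*y : ∀ {a b x y} → x ≤ a → y ≤ b → a * y + b * x ≤ a * b + x * y
a*y+b*x≤a*b+x*y {x = x} {y} x≤a y≤b with m≤n⇒∃[o]m+o≡n x≤a | m≤n⇒∃[o]m+o≡n y≤b
... | d , refl | e , refl = begin
  (x + d) * y + (y + e) * x           ≡⟨ lhs x y d e ⟩
  x * y + x * y + d * y + e * x       ≤⟨ m≤m+n _ (d * e) ⟩
  x * y + x * y + d * y + e * x + d * e ≡⟨ rhs x y d e ⟩
  (x + d) * (y + e) + x * y           ∎
  where
  open ≤-Reasoning
  lhs : ∀ x y d e → (x + d) * y + (y + e) * x ≡ x * y + x * y + d * y + e * x
  lhs = solve-∀
  rhs : ∀ x y d e → x * y + x * y + d * y + e * x + d * e ≡ (x + d) * (y + e) + x * y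
  rhs = solve-∀

chebyshev : ∀ m {F G : Fin (suc m) → ℕ} → Decreasing F → Decreasing G →
  sum F * sum G ≤ suc m * ∑[ i < suc m ] (F i * G i)
chebyshev zero {F} {G} _ _ = ≤-reflexive (lemma (F zero) (G zero))
  where
  lemma : ∀ a b → (a + 0) * (b + 0) ≡ 1 * (a * b + 0)
  lemma = solve-∀
chebyshev (suc m) {F} {G} F↓ G↓ = begin
  (a + ∑F) * (b + ∑G)                            ≡⟨ expand a b ∑F ∑G ⟩
  a * b + (a * ∑G + b * ∑F) + ∑F * ∑G            ≤⟨ +-mono-≤ (+-monoʳ-≤ (a * b) cross) tails ⟩
  a * b + (suc m * (a * b) + ∑FG) + suc m * ∑FG  ≡⟨ collect a b ∑FG (suc m) ⟩
  suc (suc m) * (a * b + ∑FG)                    ∎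
  where
  open ≤-Reasoning
  a = F zero
  b = G zero
  ∑F = ∑[ i < suc m ] F (suc i)
  ∑G = ∑[ i < suc m ] G (suc i)
  ∑FG = ∑[ i < suc m ] (F (suc i) * G (suc i))
  tails : ∑F * ∑G ≤ suc m * ∑FG
  tails = chebyshev m {F ∘ suc} {G ∘ suc} (F↓ ∘ suc) (G↓ ∘ suc)
  cross : a * ∑G + b * ∑F ≤ suc m * (a * b) + ∑FG
  cross = begin
    a * ∑G + b * ∑F
      ≡⟨ cong₂ _+_ (*-distribˡ-sum a (G ∘ suc)) (*-distribˡ-sum b (F ∘ suc)) ⟩
    ∑[ i < suc m ] (a * G (suc i)) + ∑[ i < suc m ] (b * F (suc i))
      ≡⟨ ∑-distrib-+ (λ i → a * G (suc i)) (λ i → b * F (suc i)) ⟨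
    ∑[ i < suc m ] (a * G (suc i) + b * F (suc i))
      ≤⟨ ∑-mono-≤ (λ i → a*y+b*x≤a*b+x*y (Decreasing⇒≤head {F = F} F↓ (suc i))
                                          (Decreasing⇒≤head {F = G} G↓ (suc i))) ⟩
    ∑[ i < suc m ] (a * b + F (suc i) * G (suc i))
      ≡⟨ ∑-distrib-+ (λ _ → a * b) (λ i → F (suc i) * G (suc i)) ⟩
    ∑[ i < suc m ] (a * b) + ∑FG
      ≡⟨ cong (_+ ∑FG) (∑-const (suc m) (a * b)) ⟩
    suc m * (a * b) + ∑FG
      ∎
  expand : ∀ a b x y → (a + x) * (b + y) ≡ a * b + (a * y + b * x) + x * y
  expand = solve-∀
  collect : ∀ a b s M → a * b + (M * (a * b) + s) + M * s ≡ suc M * (a * b + s)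
  collect = solve-∀

Lehmer : ℕ → Set
Lehmer zero    = ⊤
Lehmer (suc n) = Fin (suc n) × Lehmer n

∑ᴸ : ∀ n → (Lehmer n → ℕ) → ℕ
∑ᴸ zero    f = f tt
∑ᴸ (suc n) f = ∑[ c < suc n ] ∑ᴸ n (λ r → f (c , r))

∑ᴸ-cong : ∀ n {f g : Lehmer n → ℕ} → (∀ r → f r ≡ g r) → ∑ᴸ n f ≡ ∑ᴸ n g
∑ᴸ-cong zero    f≗g = f≗g tt
∑ᴸ-cong (suc n) f≗g = sum-cong-≗ {suc n} (λ c → ∑ᴸ-cong n (λ r → f≗g (c , r)))

∑ᴸ-mono-≤ : ∀ n {f g : Lehmer n → ℕ} → (∀ r → f r ≤ g r) → ∑ᴸ n f ≤ ∑ᴸ n g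
∑ᴸ-mono-≤ zero    f≤g = f≤g tt
∑ᴸ-mono-≤ (suc n) f≤g = ∑-mono-≤ (λ c → ∑ᴸ-mono-≤ n (λ r → f≤g (c , r)))

∑ᴸ-distrib-+ : ∀ n (f g : Lehmer n → ℕ) → ∑ᴸ n (λ r → f r + g r) ≡ ∑ᴸ n f + ∑ᴸ n g
∑ᴸ-distrib-+ zero    f g = refl
∑ᴸ-distrib-+ (suc n) f g = trans (sum-cong-≗ {suc n} (λ c → ∑ᴸ-distrib-+ n (λ r → f (c , r)) (λ r → g (c , r))))
  (∑-distrib-+ (λ c → ∑ᴸ n (λ r → f (c , r))) (λ c → ∑ᴸ n (λ r → g (c , r))))

∑ᴸ-zero : ∀ n → ∑ᴸ n (λ _ → 0) ≡ 0
∑ᴸ-zero zero    = refl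
∑ᴸ-zero (suc n) = trans (sum-cong-≗ {suc n} (λ _ → ∑ᴸ-zero n)) (trans (∑-const (suc n) 0) (*-zeroʳ n))

∑ᴸ-*ˡ : ∀ n c (f : Lehmer n → ℕ) → ∑ᴸ n (λ r → c * f r) ≡ c * ∑ᴸ n f
∑ᴸ-*ˡ zero    c f = refl
∑ᴸ-*ˡ (suc n) c f = trans (sum-cong-≗ {suc n} (λ i → ∑ᴸ-*ˡ n c (λ r → f (i , r))))
  (sym (*-distribˡ-sum c (λ i → ∑ᴸ n (λ r → f (i , r)))))

∑ᴸ-*ʳ : ∀ n (f : Lehmer n → ℕ) c → ∑ᴸ n (λ r → f r * c) ≡ ∑ᴸ n f * c
∑ᴸ-*ʳ n f c = begin
  ∑ᴸ n (λ r → f r * c) ≡⟨ ∑ᴸ-cong n (λ r → *-comm (f r) c) ⟩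
  ∑ᴸ n (λ r → c * f r) ≡⟨ ∑ᴸ-*ˡ n c f ⟩
  c * ∑ᴸ n f           ≡⟨ *-comm c (∑ᴸ n f) ⟩
  ∑ᴸ n f * c           ∎
  where open ≡-Reasoning

∑ₗ-∑ᴸ-comm : ∀ {A : Set} n (xs : List A) (f : A → Lehmer n → ℕ) →
  ∑ₗ xs (λ x → ∑ᴸ n (f x)) ≡ ∑ᴸ n (λ r → ∑ₗ xs (λ x → f x r))
∑ₗ-∑ᴸ-comm n []       f = sym (∑ᴸ-zero n)
∑ₗ-∑ᴸ-comm n (x ∷ xs) f =
  trans (cong (∑ᴸ n (f x) +_) (∑ₗ-∑ᴸ-comm n xs f)) (sym (∑ᴸ-distrib-+ n (f x) _))

_≟ᴸ_ : ∀ {n} → DecidableEquality (Lehmer n)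
_≟ᴸ_ {zero}  = Unit._≟_
_≟ᴸ_ {suc n} (i , r) (j , s) =
  map′ (uncurry (cong₂ _,_)) < ,-injectiveˡ , ,-injectiveʳ > (i Fin.≟ j ×-dec r ≟ᴸ s)

∑ᴸ-𝟙≟ : ∀ n (s : Lehmer n) → ∑ᴸ n (λ r → 𝟙 (s ≟ᴸ r)) ≡ 1
∑ᴸ-𝟙≟ zero    tt      = refl
∑ᴸ-𝟙≟ (suc n) (j , s) = begin
  ∑[ c < suc n ] ∑ᴸ n (λ r → 𝟙 ((j , s) ≟ᴸ (c , r)))
    ≡⟨ sum-cong-≗ {suc n} (λ c → ∑ᴸ-cong n (λ r → 𝟙-× (j Fin.≟ c) (s ≟ᴸ r))) ⟩
  ∑[ c < suc n ] ∑ᴸ n (λ r → 𝟙 (j Fin.≟ c) * 𝟙 (s ≟ᴸ r))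
    ≡⟨ sum-cong-≗ {suc n} (λ c → ∑ᴸ-*ˡ n (𝟙 (j Fin.≟ c)) (λ r → 𝟙 (s ≟ᴸ r))) ⟩
  ∑[ c < suc n ] (𝟙 (j Fin.≟ c) * ∑ᴸ n (λ r → 𝟙 (s ≟ᴸ r)))
    ≡⟨ sum-cong-≗ {suc n} (λ c → cong (𝟙 (j Fin.≟ c) *_) (∑ᴸ-𝟙≟ n s)) ⟩
  ∑[ c < suc n ] (𝟙 (j Fin.≟ c) * 1)
    ≡⟨ sum-cong-≗ {suc n} (λ c → *-identityʳ (𝟙 (j Fin.≟ c))) ⟩
  ∑[ c < suc n ] 𝟙 (j Fin.≟ c)
    ≡⟨ ∑-𝟙≟ j ⟩
  1 ∎
  where open ≡-Reasoning

Antitoneᴸ : ∀ n → (Lehmer n → ℕ) → Set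
Antitoneᴸ zero    f = ⊤
Antitoneᴸ (suc n) f = (∀ r → Decreasing (λ c → f (c , r))) × (∀ c → Antitoneᴸ n (λ r → f (c , r)))

Antitoneᴸ-cong : ∀ n {f g : Lehmer n → ℕ} → (∀ r → f r ≡ g r) → Antitoneᴸ n f → Antitoneᴸ n g
Antitoneᴸ-cong zero    f≗g _          = tt
Antitoneᴸ-cong (suc n) f≗g (f↓ , fᶜ) =
  (λ r i → subst₂ _≤_ (f≗g _) (f≗g _) (f↓ r i)) , (λ c → Antitoneᴸ-cong n (λ r → f≗g (c , r)) (fᶜ c))

Antitoneᴸ-mono : ∀ n {h : ℕ → ℕ} → (∀ {x y} → x ≤ y → h x ≤ h y) →
  ∀ {f : Lehmer n → ℕ} → Antitoneᴸ n f → Antitoneᴸ n (h ∘ f)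
Antitoneᴸ-mono zero    h↑ _         = tt
Antitoneᴸ-mono (suc n) h↑ (f↓ , fᶜ) = (λ r i → h↑ (f↓ r i)) , (λ c → Antitoneᴸ-mono n h↑ (fᶜ c))

harris : ∀ n {f g : Lehmer n → ℕ} → Antitoneᴸ n f → Antitoneᴸ n g →
  ∑ᴸ n f * ∑ᴸ n g ≤ ∑ᴸ n (λ _ → 1) * ∑ᴸ n (λ r → f r * g r)
harris zero                _         _         = ≤-reflexive (sym (+-identityʳ _))
harris (suc n) {f} {g} (f↓ , fᶜ) (g↓ , gᶜ) = begin
  sum F * sum G                           ≤⟨ chebyshev n {F} {G} F↓ G↓ ⟩
  suc n * ∑[ c < suc n ] (F c * G c)      ≤⟨ *-monoʳ-≤ (suc n) (∑-mono-≤ (λ c → harris n (fᶜ c) (gᶜ c))) ⟩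
  suc n * ∑[ c < suc n ] (K * H c)        ≡⟨ cong (suc n *_) (*-distribˡ-sum K H) ⟨
  suc n * (K * sum H)                     ≡⟨ *-assoc (suc n) K (sum H) ⟨
  suc n * K * sum H                       ≡⟨ cong (_* sum H) (∑-const (suc n) K) ⟨
  (∑[ c < suc n ] K) * sum H              ∎
  where
  open ≤-Reasoning
  F G H : Fin (suc n) → ℕ
  F c = ∑ᴸ n (λ r → f (c , r))
  G c = ∑ᴸ n (λ r → g (c , r))
  H c = ∑ᴸ n (λ r → f (c , r) * g (c , r))
  K = ∑ᴸ n (λ _ → 1)
  F↓ : Decreasing F
  F↓ i = ∑ᴸ-mono-≤ n (λ r → f↓ r i)
  G↓ : Decreasing G
  G↓ i = ∑ᴸ-mono-≤ n (λ r → g↓ r i)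

EnumeratesOnce : ∀ {X : Set} → DecidableEquality X → List X → Set
EnumeratesOnce {X} _≟_ xs = ∀ (x : X) → ∑ₗ xs (λ y → 𝟙 (y ≟ x)) ≡ 1

module _ {X : Set} (_≟_ : DecidableEquality X) {Q : X → Set} (Q? : ∀ x → Dec (Q x))
         n (φ : Lehmer n → X) (φ-injective : ∀ {r s} → φ r ≡ φ s → r ≡ s)
         (φ-into : ∀ r → Q (φ r)) (φ-onto : ∀ x → Q x → ∃ λ r → φ r ≡ x) where

  𝟙≡∑ᴸ-fibre : ∀ x → 𝟙 (Q? x) ≡ ∑ᴸ n (λ r → 𝟙 (x ≟ φ r))
  𝟙≡∑ᴸ-fibre x with Q? x
  ... | yes q = let (s , φs≡x) = φ-onto x q in sym (begin
    ∑ᴸ n (λ r → 𝟙 (x ≟ φ r)) ≡⟨ ∑ᴸ-cong n (λ r → 𝟙-cong (x ≟ φ r) (s ≟ᴸ r)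
                                  (λ x≡φr → φ-injective (trans φs≡x x≡φr)) (λ { refl → sym φs≡x })) ⟩
    ∑ᴸ n (λ r → 𝟙 (s ≟ᴸ r))  ≡⟨ ∑ᴸ-𝟙≟ n s ⟩
    1                        ∎)
    where open ≡-Reasoning
  ... | no ¬q = sym (trans (∑ᴸ-cong n (λ r → 𝟙-no (x ≟ φ r) (λ { refl → ¬q (φ-into r) }))) (∑ᴸ-zero n))

  ∑ₗ-filter-reindex : ∀ xs → EnumeratesOnce _≟_ xs → ∀ (P : X → ℕ) →
    ∑ₗ (filter Q? xs) P ≡ ∑ᴸ n (P ∘ φ)
  ∑ₗ-filter-reindex xs once P = begin
    ∑ₗ (filter Q? xs) P
      ≡⟨ ∑ₗ-filter Q? xs P ⟩
    ∑ₗ xs (λ x → 𝟙 (Q? x) * P x)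
      ≡⟨ ∑ₗ-cong xs (λ x → cong (_* P x) (𝟙≡∑ᴸ-fibre x)) ⟩
    ∑ₗ xs (λ x → ∑ᴸ n (λ r → 𝟙 (x ≟ φ r)) * P x)
      ≡⟨ ∑ₗ-cong xs (λ x → ∑ᴸ-*ʳ n (λ r → 𝟙 (x ≟ φ r)) (P x)) ⟨
    ∑ₗ xs (λ x → ∑ᴸ n (λ r → 𝟙 (x ≟ φ r) * P x))
      ≡⟨ ∑ₗ-∑ᴸ-comm n xs (λ x r → 𝟙 (x ≟ φ r) * P x) ⟩
    ∑ᴸ n (λ r → ∑ₗ xs (λ x → 𝟙 (x ≟ φ r) * P x))
      ≡⟨ ∑ᴸ-cong n (λ r → ∑ₗ-cong xs (λ x → 𝟙≟-*-subst _≟_ P x (φ r))) ⟩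
    ∑ᴸ n (λ r → ∑ₗ xs (λ x → 𝟙 (x ≟ φ r) * P (φ r)))
      ≡⟨ ∑ᴸ-cong n (λ r → ∑ₗ-*ʳ xs (λ x → 𝟙 (x ≟ φ r)) (P (φ r))) ⟩
    ∑ᴸ n (λ r → ∑ₗ xs (λ x → 𝟙 (x ≟ φ r)) * P (φ r))
      ≡⟨ ∑ᴸ-cong n (λ r → trans (cong (_* P (φ r)) (once (φ r))) (*-identityˡ (P (φ r)))) ⟩
    ∑ᴸ n (P ∘ φ)
      ∎
    where open ≡-Reasoning

_⊗∷_ : ∀ {A : Set} {m} → List A → List (Vec A m) → List (Vec A (suc m))
xs ⊗∷ vs = concatMap (λ x → map (x ∷_) vs) xs

⊗∷-enumeratesOnce : ∀ {A : Set} (_≟_ : DecidableEquality A) {m} {xs : List A} {vs : List (Vec A m)} →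
  EnumeratesOnce _≟_ xs → EnumeratesOnce (Vecₚ.≡-dec _≟_) vs → EnumeratesOnce (Vecₚ.≡-dec _≟_) (xs ⊗∷ vs)
⊗∷-enumeratesOnce {A} _≟_ {xs = xs} {vs} xs-once vs-once (y ∷ w) = begin
  ∑ₗ (xs ⊗∷ vs) (λ u → 𝟙 (u ≟ᵛ (y ∷ w)))
    ≡⟨ ∑ₗ-concatMap (λ x → map (x ∷_) vs) xs _ ⟩
  ∑ₗ xs (λ x → ∑ₗ (map (x ∷_) vs) (λ u → 𝟙 (u ≟ᵛ (y ∷ w))))
    ≡⟨ ∑ₗ-cong xs (λ x → ∑ₗ-map (x ∷_) vs _) ⟩
  ∑ₗ xs (λ x → ∑ₗ vs (λ v → 𝟙 (x ≟ y ×-dec v ≟ᵛ w)))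
    ≡⟨ ∑ₗ-cong xs (λ x → ∑ₗ-cong vs (λ v → 𝟙-× (x ≟ y) (v ≟ᵛ w))) ⟩
  ∑ₗ xs (λ x → ∑ₗ vs (λ v → 𝟙 (x ≟ y) * 𝟙 (v ≟ᵛ w)))
    ≡⟨ ∑ₗ-cong xs (λ x → ∑ₗ-*ˡ vs (𝟙 (x ≟ y)) _) ⟩
  ∑ₗ xs (λ x → 𝟙 (x ≟ y) * ∑ₗ vs (λ v → 𝟙 (v ≟ᵛ w)))
    ≡⟨ ∑ₗ-cong xs (λ x → trans (cong (𝟙 (x ≟ y) *_) (vs-once w)) (*-identityʳ _)) ⟩
  ∑ₗ xs (λ x → 𝟙 (x ≟ y))
    ≡⟨ xs-once y ⟩
  1 ∎
  where
  open ≡-Reasoning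
  _≟ᵛ_ : ∀ {k} → DecidableEquality (Vec A k)
  _≟ᵛ_ = Vecₚ.≡-dec _≟_

_≟ˢ_ : ∀ {n} → DecidableEquality (Subset n)
_≟ˢ_ = Vecₚ.≡-dec Bool._≟_

allSubsets-enumeratesOnce : ∀ n → EnumeratesOnce _≟ˢ_ (allSubsets n)
allSubsets-enumeratesOnce zero    [] = refl
allSubsets-enumeratesOnce (suc n) T  =
  subst (λ ys → ∑ₗ ys (λ S → 𝟙 (S ≟ˢ T)) ≡ 1) allSubsets≡⊗∷
    (⊗∷-enumeratesOnce Bool._≟_ {xs = outside ∷ inside ∷ []} {allSubsets n}
       bools-once (allSubsets-enumeratesOnce n) T)
  where
  allSubsets≡⊗∷ : (outside ∷ inside ∷ []) ⊗∷ allSubsets n ≡ allSubsets (suc n)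
  allSubsets≡⊗∷ = cong (map (outside ∷_) (allSubsets n) ++_) (++-identityʳ _)
  bools-once : EnumeratesOnce Bool._≟_ (outside ∷ inside ∷ [])
  bools-once false = refl
  bools-once true  = refl

allSeqs-enumeratesOnce : ∀ {n} m → EnumeratesOnce (Vecₚ.≡-dec _≟ˢ_) (allSeqs {n} m)
allSeqs-enumeratesOnce zero    [] = refl
allSeqs-enumeratesOnce (suc m)    =
  ⊗∷-enumeratesOnce _≟ˢ_ {xs = allSubsets _} {allSeqs m} (allSubsets-enumeratesOnce _) (allSeqs-enumeratesOnce m)

∷-⊆-∷ : ∀ {m n} {s t} {p q : Subset m} {p′ q′ : Subset n} →
  s ∷ p ⊆ t ∷ q → p′ ⊆ q′ → s ∷ p′ ⊆ t ∷ q′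
∷-⊆-∷ {s = outside} _     p′⊆q′ = out⊆ p′⊆q′
∷-⊆-∷ {s = inside}  sp⊆tq p′⊆q′ with sp⊆tq here
... | here = in⊆in p′⊆q′

insertAt-mono-⊆ : ∀ {n} {p q : Subset n} c {s} → p ⊆ q → insertAt p c s ⊆ insertAt q c s
insertAt-mono-⊆                         zero    p⊆q = s⊆s p⊆q
insertAt-mono-⊆ {p = _ ∷ _} {q = _ ∷ _} (suc c) p⊆q = ∷-⊆-∷ p⊆q (insertAt-mono-⊆ c (drop-∷-⊆ p⊆q))

removeAt-mono-⊆ : ∀ {n} {p q : Subset (suc n)} c → p ⊆ q → removeAt p c ⊆ removeAt q c
removeAt-mono-⊆ {p = _ ∷ _}     {q = _ ∷ _}     zero    p⊆q = drop-∷-⊆ p⊆q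
removeAt-mono-⊆ {suc n} {_ ∷ _ ∷ _} {_ ∷ _ ∷ _} (suc c) p⊆q = ∷-⊆-∷ p⊆q (removeAt-mono-⊆ c (drop-∷-⊆ p⊆q))

∣insertAt-inside∣ : ∀ {n} (p : Subset n) c → ∣ insertAt p c inside ∣ ≡ suc ∣ p ∣
∣insertAt-inside∣ p             zero    = refl
∣insertAt-inside∣ (inside ∷ p)  (suc c) = cong suc (∣insertAt-inside∣ p c)
∣insertAt-inside∣ (outside ∷ p) (suc c) = ∣insertAt-inside∣ p c

insertAt-removeAt-∈ : ∀ {n} {p : Subset (suc n)} {c} → c ∈ p → insertAt (removeAt p c) c inside ≡ p
insertAt-removeAt-∈ {p = p} {c} c∈p = trans (cong (insertAt (removeAt p c) c) (sym ([]=⇒lookup c∈p))) (insertAt-removeAt p c)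

∣removeAt-∈∣ : ∀ {n} {p : Subset (suc n)} {c} → c ∈ p → ∣ p ∣ ≡ suc ∣ removeAt p c ∣
∣removeAt-∈∣ {p = p} {c} c∈p =
  trans (cong ∣_∣ (sym (insertAt-removeAt-∈ c∈p))) (∣insertAt-inside∣ (removeAt p c) c)

insertAt-⊥-injective : ∀ {n} (c d : Fin (suc n)) → insertAt ⊥ c inside ≡ insertAt ⊥ d inside → c ≡ d
insertAt-⊥-injective         zero    zero    _  = refl
insertAt-⊥-injective {suc n} zero    (suc d) ()
insertAt-⊥-injective {suc n} (suc c) zero    ()
insertAt-⊥-injective {suc n} (suc c) (suc d) eq = cong suc (insertAt-⊥-injective c d (Vecₚ.∷-injectiveʳ eq))

∣p∣≡0⇒p≡⊥ : ∀ {n} {p : Subset n} → ∣ p ∣ ≡ 0 → p ≡ ⊥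
∣p∣≡0⇒p≡⊥ {p = p} ∣p∣≡0 =
  Empty-unique λ (x , x∈p) → n≮0 (subst (∣ p - x ∣ <_) ∣p∣≡0 (x∈p⇒∣p-x∣<∣p∣ x∈p))

∣p∣≡1+k⇒Nonempty : ∀ {n k} {p : Subset n} → ∣ p ∣ ≡ suc k → Nonempty p
∣p∣≡1+k⇒Nonempty {n} {p = p} ∣p∣≡1+k with nonempty? p
... | yes ne = ne
... | no ¬ne = contradiction (trans (sym ∣p∣≡1+k) (trans (cong ∣_∣ (Empty-unique ¬ne)) (∣⊥∣≡0 n))) λ ()

map-injective : ∀ {A B : Set} {m} {f : A → B} → (∀ {x y} → f x ≡ f y → x ≡ y) →
  ∀ {v w : Vec A m} → Vec.map f v ≡ Vec.map f w → v ≡ w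
map-injective f-inj {[]}    {[]}    _  = refl
map-injective f-inj {_ ∷ _} {_ ∷ _} eq =
  cong₂ _∷_ (f-inj (Vecₚ.∷-injectiveˡ eq)) (map-injective f-inj (Vecₚ.∷-injectiveʳ eq))

insertIn : ∀ {n} → Fin (suc n) → Subset n → Subset (suc n)
insertIn c p = insertAt p c inside

-- The code (c , r) first adds the element c, then follows the chain coded by r on the
-- remaining n elements, relabelled by punchIn c.
lehmerChain : ∀ n → Lehmer n → Vec (Subset n) (suc n)
lehmerChain zero    tt      = ⊥ ∷ []
lehmerChain (suc n) (c , r) = ⊥ ∷ Vec.map (insertIn c) (lehmerChain n r)

lehmerChain-head : ∀ n (r : Lehmer n) → lookup (lehmerChain n r) zero ≡ ⊥
lehmerChain-head zero    _ = refl
lehmerChain-head (suc n) _ = refl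

lehmerChain-isMaxChain : ∀ n (r : Lehmer n) → IsMaxChain (lehmerChain n r)
lehmerChain-isMaxChain zero    tt      = (λ { zero → refl }) , λ ()
lehmerChain-isMaxChain (suc n) (c , r) = size , nested
  where
  C = lehmerChain n r
  ins = insertIn c
  size : ∀ i → ∣ lookup (⊥ ∷ Vec.map ins C) i ∣ ≡ toℕ i
  size zero    = ∣⊥∣≡0 (suc n)
  size (suc i) = begin
    ∣ lookup (Vec.map ins C) i ∣ ≡⟨ cong ∣_∣ (lookup-map i ins C) ⟩
    ∣ ins (lookup C i) ∣         ≡⟨ ∣insertAt-inside∣ (lookup C i) c ⟩
    suc ∣ lookup C i ∣           ≡⟨ cong suc (proj₁ (lehmerChain-isMaxChain n r) i) ⟩
    suc (toℕ i)                  ∎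
    where open ≡-Reasoning
  nested : ∀ i → lookup (⊥ ∷ Vec.map ins C) (inject₁ i) ⊆ lookup (⊥ ∷ Vec.map ins C) (suc i)
  nested zero    = ⊆-min _
  nested (suc i) = subst₂ _⊆_ (sym (lookup-map (inject₁ i) ins C)) (sym (lookup-map (suc i) ins C))
                     (insertAt-mono-⊆ c (proj₂ (lehmerChain-isMaxChain n r) i))

lehmerChain-injective : ∀ n {r s : Lehmer n} → lehmerChain n r ≡ lehmerChain n s → r ≡ s
lehmerChain-injective zero    {tt}    {tt}    _  = refl
lehmerChain-injective (suc n) {c , r} {d , s} eq = same-first c≡d tails
  where
  ins = insertIn {n}
  tails = Vecₚ.∷-injectiveʳ eq
  c≡d : c ≡ d
  c≡d = insertAt-⊥-injective c d (begin
    ins c ⊥                                         ≡⟨ cong (ins c) (lehmerChain-head n r) ⟨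
    ins c (lookup (lehmerChain n r) zero)           ≡⟨ lookup-map zero (ins c) (lehmerChain n r) ⟨
    lookup (Vec.map (ins c) (lehmerChain n r)) zero ≡⟨ cong (λ C → lookup C zero) tails ⟩
    lookup (Vec.map (ins d) (lehmerChain n s)) zero ≡⟨ lookup-map zero (ins d) (lehmerChain n s) ⟩
    ins d (lookup (lehmerChain n s) zero)           ≡⟨ cong (ins d) (lehmerChain-head n s) ⟩
    ins d ⊥                                         ∎)
    where open ≡-Reasoning
  ins-injective : ∀ {c p q} → ins c p ≡ ins c q → p ≡ q
  ins-injective {c} {p} {q} eq = begin
    p                      ≡⟨ Vecₚ.removeAt-insertAt p c inside ⟨
    removeAt (ins c p) c   ≡⟨ cong (λ x → removeAt x c) eq ⟩
    removeAt (ins c q) c   ≡⟨ Vecₚ.removeAt-insertAt q c inside ⟩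
    q                      ∎
    where open ≡-Reasoning
  same-first : c ≡ d → Vec.map (ins c) (lehmerChain n r) ≡ Vec.map (ins d) (lehmerChain n s) → (c , r) ≡ (d , s)
  same-first refl eq = cong (c ,_) (lehmerChain-injective n (map-injective ins-injective eq))

head⊆lookup : ∀ {n m} (C : Vec (Subset n) (suc m)) → (∀ j → lookup C (inject₁ j) ⊆ lookup C (suc j)) →
  ∀ i → lookup C zero ⊆ lookup C i
head⊆lookup C             nested zero    = λ x∈ → x∈
head⊆lookup (p ∷ q ∷ C)   nested (suc i) = λ x∈p → head⊆lookup (q ∷ C) (nested ∘ suc) i (nested zero x∈p)

map-insertAt-removeAt : ∀ {n m c} (C : Vec (Subset (suc n)) m) → (∀ i → c ∈ lookup C i) →
  Vec.map (insertIn c) (Vec.map (λ p → removeAt p c) C) ≡ C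
map-insertAt-removeAt []      _   = refl
map-insertAt-removeAt (p ∷ C) c∈C = cong₂ _∷_ (insertAt-removeAt-∈ (c∈C zero)) (map-insertAt-removeAt C (c∈C ∘ suc))

removeAt-isMaxChain : ∀ {n c} (C : Vec (Subset (suc n)) (suc n)) →
  (∀ i → ∣ lookup C i ∣ ≡ suc (toℕ i)) → (∀ j → lookup C (inject₁ j) ⊆ lookup C (suc j)) →
  (∀ i → c ∈ lookup C i) → IsMaxChain (Vec.map (λ p → removeAt p c) C)
removeAt-isMaxChain {c = c} C size nested c∈C = size′ , nested′
  where
  rem = λ p → removeAt p c
  size′ : ∀ i → ∣ lookup (Vec.map rem C) i ∣ ≡ toℕ i
  size′ i = trans (cong ∣_∣ (lookup-map i rem C)) (suc-injective (trans (sym (∣removeAt-∈∣ (c∈C i))) (size i)))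
  nested′ : ∀ j → lookup (Vec.map rem C) (inject₁ j) ⊆ lookup (Vec.map rem C) (suc j)
  nested′ j = subst₂ _⊆_ (sym (lookup-map (inject₁ j) rem C)) (sym (lookup-map (suc j) rem C))
                (removeAt-mono-⊆ c (nested j))

lehmerChain-surjective : ∀ n (C : Vec (Subset n) (suc n)) → IsMaxChain C → ∃ λ r → lehmerChain n r ≡ C
lehmerChain-surjective zero    ([] ∷ []) _                = tt , refl
lehmerChain-surjective (suc n) (C₀ ∷ C)  (size , nested) with ∣p∣≡1+k⇒Nonempty (size (suc zero))
... | c , c∈C₁ =
  let r , r↦C′ = lehmerChain-surjective n (Vec.map (λ p → removeAt p c) C)
                   (removeAt-isMaxChain C (size ∘ suc) (nested ∘ suc) c∈C)
  in (c , r) , cong₂ _∷_ (sym (∣p∣≡0⇒p≡⊥ (size zero)))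
                 (trans (cong (Vec.map (insertIn c)) r↦C′) (map-insertAt-removeAt C c∈C))
  where
  c∈C : ∀ i → c ∈ lookup C i
  c∈C i = head⊆lookup C (nested ∘ suc) i c∈C₁

∑ₗ-maxChains : ∀ n (P : Vec (Subset n) (suc n) → ℕ) → ∑ₗ (maxChains n) P ≡ ∑ᴸ n (P ∘ lehmerChain n)
∑ₗ-maxChains n = ∑ₗ-filter-reindex (Vecₚ.≡-dec _≟ˢ_) isMaxChain? n (lehmerChain n) (lehmerChain-injective n)
  (lehmerChain-isMaxChain n) (lehmerChain-surjective n) (allSeqs (suc n)) (allSeqs-enumeratesOnce (suc n))

count-maxChains : ∀ n {P : Vec (Subset n) (suc n) → Set} (P? : ∀ C → Dec (P C)) →
  length (filter P? (maxChains n)) ≡ ∑ᴸ n (λ r → 𝟙 (P? (lehmerChain n r)))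
count-maxChains n P? = trans (length-filter P? (maxChains n)) (∑ₗ-maxChains n (𝟙 ∘ P?))

𝟙∈ : ∀ {n} (F : Family n) S → ℕ
𝟙∈ F S = 𝟙 (T? (F S))

N≡∑ₗ : ∀ {n m} (F : Family n) (C : Vec (Subset n) m) → N F C ≡ ∑ₗ (Vec.toList C) (𝟙∈ F)
N≡∑ₗ F C = length-filter (λ S → T? (F S)) (Vec.toList C)

N-∷-map : ∀ {k n m} (F : Family n) (S : Subset n) (g : Subset k → Subset n) (C : Vec (Subset k) m) →
  N F (S ∷ Vec.map g C) ≡ 𝟙∈ F S + N (F ∘ g) C
N-∷-map F S g C = begin
  N F (S ∷ Vec.map g C)                             ≡⟨ N≡∑ₗ F (S ∷ Vec.map g C) ⟩
  𝟙∈ F S + ∑ₗ (Vec.toList (Vec.map g C)) (𝟙∈ F)   ≡⟨ cong (λ xs → 𝟙∈ F S + ∑ₗ xs (𝟙∈ F)) (Vecₚ.toList-map g C) ⟩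
  𝟙∈ F S + ∑ₗ (map g (Vec.toList C)) (𝟙∈ F)       ≡⟨ cong (𝟙∈ F S +_) (∑ₗ-map g (Vec.toList C) (𝟙∈ F)) ⟩
  𝟙∈ F S + ∑ₗ (Vec.toList C) (𝟙∈ (F ∘ g))         ≡⟨ cong (𝟙∈ F S +_) (N≡∑ₗ (F ∘ g) C) ⟨
  𝟙∈ F S + N (F ∘ g) C                             ∎
  where open ≡-Reasoning

N-mono : ∀ {n m} {F G : Family n} → (∀ S → F S ≡ true → G S ≡ true) → ∀ (C : Vec (Subset n) m) → N F C ≤ N G C
N-mono {F = F} {G} F⊆G C = subst₂ _≤_ (sym (N≡∑ₗ F C)) (sym (N≡∑ₗ G C)) (∑ₗ-mono-≤ (Vec.toList C) 𝟙∈-mono)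
  where
  𝟙∈-mono : ∀ S → 𝟙∈ F S ≤ 𝟙∈ G S
  𝟙∈-mono S with F S in FS
  ... | false = z≤n
  ... | true  rewrite F⊆G S FS = ≤-refl

insertAt-suc≡insertAt-inject₁ : ∀ {A : Set} {n} (xs : Vec A n) c {v} → lookup xs c ≡ v →
  insertAt xs (suc c) v ≡ insertAt xs (inject₁ c) v
insertAt-suc≡insertAt-inject₁ (x ∷ xs) zero    refl = refl
insertAt-suc≡insertAt-inject₁ (x ∷ xs) (suc c) eq   = cong (x ∷_) (insertAt-suc≡insertAt-inject₁ xs c eq)

lookup-insertAt-suc-inject₁ : ∀ {A : Set} {n} (xs : Vec A n) c v → lookup (insertAt xs (suc c) v) (inject₁ c) ≡ lookup xs c
lookup-insertAt-suc-inject₁ (x ∷ xs) zero    v = refl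
lookup-insertAt-suc-inject₁ (x ∷ xs) (suc c) v = lookup-insertAt-suc-inject₁ xs c v

insertAt-suc-shift : ∀ {A : Set} {n} (xs : Vec A n) c {v w} → lookup xs c ≡ w →
  (insertAt xs (suc c) v [ suc c ]≔ w) [ inject₁ c ]≔ v ≡ insertAt xs (inject₁ c) v
insertAt-suc-shift (x ∷ xs) zero    refl = refl
insertAt-suc-shift (x ∷ xs) (suc c) eq   = cong (x ∷_) (insertAt-suc-shift xs c eq)

insertAt-[]≔ : ∀ {A : Set} {n} (xs : Vec A n) c j (v w : A) →
  insertAt (xs [ j ]≔ w) c v ≡ insertAt xs c v [ punchIn c j ]≔ w
insertAt-[]≔ xs       zero    j       v w = refl
insertAt-[]≔ (x ∷ xs) (suc c) zero    v w = refl
insertAt-[]≔ (x ∷ xs) (suc c) (suc j) v w = cong (x ∷_) (insertAt-[]≔ xs c j v w)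

punchIn-mono-< : ∀ {n} c (i j : Fin n) → i <ᶠ j → punchIn c i <ᶠ punchIn c j
punchIn-mono-< c i j i<j =
  Finₚ.≤∧≢⇒< (Finₚ.punchIn-mono-≤ c i j (<⇒≤ i<j)) (Finₚ.<⇒≢ i<j ∘ Finₚ.punchIn-injective c i j)

LeftCompressed-shift : ∀ {n} {F : Family (suc n)} → LeftCompressed F → ∀ (c : Fin n) (p : Subset n) →
  F (insertIn (suc c) p) ≡ true → F (insertIn (inject₁ c) p) ≡ true
LeftCompressed-shift {F = F} compressed c p Fp with lookup p c in pc
... | inside  = subst (λ q → F q ≡ true) (insertAt-suc≡insertAt-inject₁ p c pc) Fp
... | outside = subst (λ q → F q ≡ true) (insertAt-suc-shift p c pc)
  (compressed (inject₁ c) (suc c) (Finₚ.≤̄⇒inject₁< ≤-refl) (insertAt p (suc c) inside) c∉ c+1∈ Fp)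
  where
  c∉ : inject₁ c ∉ insertAt p (suc c) inside
  c∉ c∈ with trans (sym ([]=⇒lookup c∈)) (trans (lookup-insertAt-suc-inject₁ p c inside) pc)
  ... | ()
  c+1∈ : suc c ∈ insertAt p (suc c) inside
  c+1∈ = lookup⇒[]= (suc c) _ (Vecₚ.insertAt-lookup p (suc c) inside)

LeftCompressed-link : ∀ {n} {F : Family (suc n)} → LeftCompressed F → ∀ c →
  LeftCompressed (F ∘ insertIn c)
LeftCompressed-link {F = F} compressed c i j i<j p i∉p j∈p Fp =
  subst (λ q → F q ≡ true) (sym (trans (insertAt-[]≔ (p [ j ]≔ outside) c i inside inside)
                                       (cong (_[ punchIn c i ]≔ inside) (insertAt-[]≔ p c j inside outside))))
    (compressed (punchIn c i) (punchIn c j) (punchIn-mono-< c i j i<j) (insertAt p c inside)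
      (λ ci∈ → i∉p (lookup⇒[]= i p (trans (sym (Vecₚ.insertAt-punchIn p c inside i)) ([]=⇒lookup ci∈))))
      (lookup⇒[]= (punchIn c j) _ (trans (Vecₚ.insertAt-punchIn p c inside j) ([]=⇒lookup j∈p)))
      Fp)

N-lehmerChain-antitone : ∀ n {F : Family n} → LeftCompressed F → Antitoneᴸ n (λ r → N F (lehmerChain n r))
N-lehmerChain-antitone zero    _                = tt
N-lehmerChain-antitone (suc n) {F} compressed = shift , link
  where
  ins = insertIn {n}
  N-split : ∀ c r → N F (lehmerChain (suc n) (c , r)) ≡ 𝟙∈ F ⊥ + N (F ∘ ins c) (lehmerChain n r)
  N-split c r = N-∷-map F ⊥ (ins c) (lehmerChain n r)
  shift : ∀ r → Decreasing (λ c → N F (lehmerChain (suc n) (c , r)))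
  shift r i = subst₂ _≤_ (sym (N-split (suc i) r)) (sym (N-split (inject₁ i) r))
    (+-monoʳ-≤ (𝟙∈ F ⊥) (N-mono (LeftCompressed-shift compressed i) (lehmerChain n r)))
  link : ∀ c → Antitoneᴸ n (λ r → N F (lehmerChain (suc n) (c , r)))
  link c = Antitoneᴸ-cong n (λ r → sym (N-split c r))
    (Antitoneᴸ-mono n (+-monoʳ-≤ (𝟙∈ F ⊥)) (N-lehmerChain-antitone n (LeftCompressed-link compressed c)))

theorem7 : ∀ (n : ℕ) (A B : Family n) → LeftCompressed A → LeftCompressed B →
    ∀ (k l : ℕ) →
    length (maxChains n) * countAB A k B l ≥ countA A k * countA B l
theorem7 n A B compressedA compressedB k l = begin
  countA A k * countA B l                        ≡⟨ cong₂ _*_ (count-maxChains n _) (count-maxChains n _) ⟩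
  ∑ᴸ n a * ∑ᴸ n b                                ≤⟨ harris n (antitone A compressedA k) (antitone B compressedB l) ⟩
  ∑ᴸ n (λ _ → 1) * ∑ᴸ n (λ r → a r * b r)        ≡⟨ cong₂ _*_ count-all count-both ⟨
  length (maxChains n) * countAB A k B l         ∎
  where
  open ≤-Reasoning
  a b : Lehmer n → ℕ
  a r = 𝟙 (k ≤? N A (lehmerChain n r))
  b r = 𝟙 (l ≤? N B (lehmerChain n r))
  antitone : ∀ F → LeftCompressed F → ∀ k → Antitoneᴸ n (λ r → 𝟙 (k ≤? N F (lehmerChain n r)))
  antitone F compressed k = Antitoneᴸ-mono n (𝟙-≤?-mono k) (N-lehmerChain-antitone n compressed)
  count-all : length (maxChains n) ≡ ∑ᴸ n (λ _ → 1)
  count-all = trans (length≡∑ₗ1 (maxChains n)) (∑ₗ-maxChains n (λ _ → 1))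
  count-both : countAB A k B l ≡ ∑ᴸ n (λ r → a r * b r)
  count-both = trans (count-maxChains n (λ C → k ≤? N A C ×-dec l ≤? N B C))
                     (∑ᴸ-cong n (λ r → 𝟙-× (k ≤? N A (lehmerChain n r)) (l ≤? N B (lehmerChain n r))))
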